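{- Let $n\ge 2$ and $i,j,k,l,r,s\in\{0,1,\ldots,n-1\}$ with $i\ne j$, $k\ne l$, $r\ne s$. Suppose $p_1\sim_n|10^i-10^j|$, $p_2\sim_n|10^k-10^l|$, $p_3\sim_n|10^r-10^s|$, where $p_1,p_2,p_3$ are distinct. If $p_1+p_2,\ p_2+p_3,\ p_1+p_3\in C(n-1)$, then either $p_1+p_2+p_3=\mathbf{0}$ or $\{i,j\}\cap\{k,l\}=\{i,j\}\cap\{r,s\}=\{k,l\}\cap\{r,s\}$.
   Context: $C(n-1)$ is the set of non-zero vectors in $\mathbb{Z}_2^{n-1}$ whose $1$'s occupy consecutive coordinates. Notation: for distinct $a,b\in\{0,\ldots,n-1\}$, $p\sim_n|10^a-10^b|$ means that $p\in\mathbb{Z}_2^{n-1}$ is the vector with $1$'s exactly in the coordinates $k$ (from the left) with $n-\max(a,b)\le k\le n-\min(a,b)-1$ and $0$ elsewhere (the code of the edge joining vertices $10^a$ and $10^b$). -}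

module Defs where

open import Data.Nat using (ℕ; _∸_; _+_; _≤_; _<_; _≤ᵇ_; _⊔_; _⊓_)
open import Data.Bool using (Bool; true; false; _∧_; _xor_)
open import Data.Fin using (Fin; toℕ)
open import Data.Vec using (Vec; tabulate; zipWith; replicate; lookup)
open import Data.Product using (Σ; _×_)
open import Relation.Binary.PropositionalEquality using (_≡_)

-- Vectors of ℤ₂^m are Vec Bool m (true = 1); Vec index t is coordinate t+1 from the left.

_⊕_ : {m : ℕ} → Vec Bool m → Vec Bool m → Vec Bool m
_⊕_ = zipWith _xor_

𝟎 : (m : ℕ) → Vec Bool m
𝟎 m = replicate m false

-- C(m): non-zero vectors whose 1's occupy consecutive coordinates,
-- i.e. the 1's are exactly the coordinates lo..hi for some lo ≤ hi < m.
InC : (m : ℕ) → Vec Bool m → Set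
InC m v = Σ ℕ λ lo → Σ ℕ λ hi → lo ≤ hi × hi < m ×
  ((t : Fin m) → lookup v t ≡ ((lo ≤ᵇ toℕ t) ∧ (toℕ t ≤ᵇ hi)))

-- The code of the edge |10^a - 10^b| in ℤ₂^(n-1): coordinate k (1-based from left)
-- is 1 iff n - max(a,b) ≤ k ≤ n - min(a,b) - 1.
edgeCode : (n a b : ℕ) → Vec Bool (n ∸ 1)
edgeCode n a b = tabulate λ t →
  (n ∸ (a ⊔ b) ≤ᵇ (toℕ t + 1)) ∧ ((toℕ t + 1) ≤ᵇ (n ∸ (a ⊓ b) ∸ 1))

module Submission where

-- Write m = n - 1 and give the vertex 10^a (0 ≤ a ≤ m) the position pos a = m - a.
-- Coordinate t (counted from 0) of the edge code of {a,b} is 1 exactly when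
-- [pos a ≤ t] xor [pos b ≤ t], i.e. when t lies in the half-open interval between
-- pos a and pos b.  The proof rests on three facts.
--  (1) The sum of two intervals with four distinct ends takes the values 1,0,1 at
--      three increasing coordinates, so it is not in C (whose 1's are consecutive).
--      Hence two edges whose codes sum into C share a vertex.
--  (2) Distinct edges through a common vertex v intersect exactly in {v}.
--  (3) The codes of the sides of a triangle sum to zero: each step [pos a ≤ t]
--      occurs twice.
-- For the theorem, edges 1 and 2 share a vertex v.  If v lies on edge 3, all three
-- pairwise intersections are {v} by (2).  Otherwise edge 3 meets edges 1 and 2 in
-- their other ends, which are distinct, so the three edges form a triangle and (3)
-- applies.

open import Defs
open import Data.Nat using (ℕ; suc; _+_; _∸_; _≤_; _<_; _≤ᵇ_; _⊔_; _⊓_; s≤s)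
open import Data.Nat.Properties hiding (_≟_)
open import Data.Bool using (Bool; true; false; _∧_; _xor_)
open import Data.Bool.Properties using (xor-comm; xor-same; T-≡; T-∧)
open import Data.Fin using (Fin; toℕ; fromℕ<; _≟_)
open import Data.Fin.Properties using (toℕ-injective; toℕ≤pred[n]; toℕ-fromℕ<)
open import Data.Fin.Subset using (Subset; ⁅_⁆; _∪_; _∩_; ⊥; Empty)
open import Data.Fin.Subset.Properties
  using (Empty-unique; x∈p∩q⁻; x∈⁅y⁆⇒x≡y; ∪-distribˡ-∩; ∪-identityʳ; ∪-comm)
open import Data.Vec using (Vec; lookup)
open import Data.Vec.Properties using (lookup∘tabulate; lookup-zipWith; lookup-replicate)
open import Data.Vec.Relation.Binary.Pointwise.Extensional using (ext; Pointwise-≡⇒≡)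
open import Data.Product using (Σ-syntax; _×_; _,_; proj₁; proj₂)
open import Data.Sum using (_⊎_; inj₁; inj₂)
open import Function using (_∘_)
open import Function.Bundles using (Equivalence)
open import Relation.Nullary using (¬_; yes; no; contradiction)
open import Relation.Nullary.Decidable using (_⊎-dec_)
open import Relation.Nullary.Reflects using (ofʸ; ofⁿ)
open import Relation.Binary.PropositionalEquality
open import Relation.Binary.Definitions using (tri<; tri≈; tri>)

step : ℕ → ℕ → Bool
step w u = w ≤ᵇ u

step-on : ∀ {w u} → w ≤ u → step w u ≡ true
step-on {w} {u} w≤u with w ≤ᵇ u | ≤ᵇ-reflects-≤ w u
... | true  | _        = refl
... | false | ofⁿ w≰u = contradiction w≤u w≰u

step-off : ∀ {w u} → u < w → step w u ≡ false
step-off {w} {u} u<w with w ≤ᵇ u | ≤ᵇ-reflects-≤ w u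
... | false | _        = refl
... | true  | ofʸ w≤u = contradiction w≤u (<⇒≱ u<w)

interval : ℕ → ℕ → ℕ → Bool
interval w x u = step w u xor step x u

interval-sym : ∀ w x u → interval w x u ≡ interval x w u
interval-sym w x u = xor-comm (step w u) (step x u)

interval-inside : ∀ {w x u} → w ≤ u → u < x → interval w x u ≡ true
interval-inside w≤u u<x = cong₂ _xor_ (step-on w≤u) (step-off u<x)

interval-below : ∀ {w x u} → u < w → u < x → interval w x u ≡ false
interval-below u<w u<x = cong₂ _xor_ (step-off u<w) (step-off u<x)

interval-above : ∀ {w x u} → w ≤ u → x ≤ u → interval w x u ≡ false
interval-above w≤u x≤u = cong₂ _xor_ (step-on w≤u) (step-on x≤u)

window : ∀ {β α} t → β ≤ α → ((suc β ≤ᵇ suc t) ∧ (suc t ≤ᵇ α)) ≡ interval β α t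
window {β} {α} t β≤α with β ≤? t | α ≤? t
... | yes β≤t | yes α≤t
  rewrite step-on {suc β} (s≤s β≤t) | step-off {suc t} (s≤s α≤t)
        | step-on β≤t | step-on α≤t = refl
... | yes β≤t | no α≰t
  rewrite step-on {suc β} (s≤s β≤t) | step-on {suc t} (≰⇒> α≰t)
        | step-on β≤t | step-off (≰⇒> α≰t) = refl
... | no β≰t | _
  rewrite step-off {suc β} (s≤s (≰⇒> β≰t))
        | step-off (≰⇒> β≰t) | step-off (<-≤-trans (≰⇒> β≰t) β≤α) = refl

record Realizes {m : ℕ} (v : Vec Bool m) (f : ℕ → Bool) : Set where
  constructor realizes
  field coordinate : ∀ t → lookup v t ≡ f (toℕ t)
open Realizes

realizes-≗ : ∀ {m} {v : Vec Bool m} {f g : ℕ → Bool} → Realizes v f → (∀ u → f u ≡ g u) →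
  Realizes v g
realizes-≗ real f≗g = realizes λ t → trans (coordinate real t) (f≗g (toℕ t))

window-in : ∀ {lo u hi} → lo ≤ u → u ≤ hi → ((lo ≤ᵇ u) ∧ (u ≤ᵇ hi)) ≡ true
window-in lo≤u u≤hi = cong₂ _∧_ (step-on lo≤u) (step-on u≤hi)

window-out : ∀ lo u hi → ((lo ≤ᵇ u) ∧ (u ≤ᵇ hi)) ≡ true → lo ≤ u × u ≤ hi
window-out lo u hi e with Equivalence.to T-∧ (Equivalence.from T-≡ e)
... | lo≤ᵇu , u≤ᵇhi = ≤ᵇ⇒≤ lo u lo≤ᵇu , ≤ᵇ⇒≤ u hi u≤ᵇhi

C-convex : ∀ {m v f u₁ u₂ u₃} → Realizes {m} v f → u₁ < u₂ → u₂ < u₃ → u₃ < m →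
  f u₁ ≡ true → f u₂ ≡ false → f u₃ ≡ true → ¬ InC m v
C-convex {m} {v} {f} {u₁} {u₂} {u₃} real u₁<u₂ u₂<u₃ u₃<m f₁ f₂ f₃ (lo , hi , _ , _ , coords) =
  contradiction (trans (sym f₂) (trans (at u₂<m) (window-in {lo} lo≤u₂ u₂≤hi))) λ ()
  where
  at : ∀ {u} (u<m : u < m) → f u ≡ ((lo ≤ᵇ u) ∧ (u ≤ᵇ hi))
  at {u} u<m = begin
    f u                                     ≡⟨ cong f (sym (toℕ-fromℕ< u<m)) ⟩
    f (toℕ (fromℕ< u<m))                    ≡⟨ sym (coordinate real (fromℕ< u<m)) ⟩
    lookup v (fromℕ< u<m)                   ≡⟨ coords (fromℕ< u<m) ⟩
    (lo ≤ᵇ toℕ (fromℕ< u<m)) ∧ (toℕ (fromℕ< u<m) ≤ᵇ hi)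
      ≡⟨ cong (λ z → (lo ≤ᵇ z) ∧ (z ≤ᵇ hi)) (toℕ-fromℕ< u<m) ⟩
    (lo ≤ᵇ u) ∧ (u ≤ᵇ hi)                   ∎
    where open ≡-Reasoning
  u₂<m : u₂ < m
  u₂<m = <-trans u₂<u₃ u₃<m
  lo≤u₁ : lo ≤ u₁
  lo≤u₁ = proj₁ (window-out lo u₁ hi (trans (sym (at (<-trans u₁<u₂ u₂<m))) f₁))
  u₃≤hi : u₃ ≤ hi
  u₃≤hi = proj₂ (window-out lo u₃ hi (trans (sym (at u₃<m)) f₃))
  lo≤u₂ : lo ≤ u₂
  lo≤u₂ = ≤-trans lo≤u₁ (<⇒≤ u₁<u₂)
  u₂≤hi : u₂ ≤ hi
  u₂≤hi = ≤-trans (<⇒≤ u₂<u₃) u₃≤hi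

interval-sum : ℕ → ℕ → ℕ → ℕ → ℕ → Bool
interval-sum w x y z u = interval w x u xor interval y z u

-- Fact (1).  The sum of the intervals [w,x) and [y,z) with w < x, y < z, w < y and
-- four distinct ends is not in C: it is 1 at w and 0, 1 at the next two ends.
two-intervals-sorted : ∀ {m v w x y z} → w < x → y < z → w < y → x ≢ y → x ≢ z →
  x ≤ m → z ≤ m → Realizes {m} v (interval-sum w x y z) → ¬ InC m v
two-intervals-sorted {w = w} {x} {y} {z} w<x y<z w<y x≢y x≢z x≤m z≤m real
  with <-cmp x y
... | tri≈ _ x≡y _ = contradiction x≡y x≢y
... | tri< x<y _ _ =
  -- disjoint intervals: 1, 0, 1 at w, x, y
  C-convex real w<x x<y (<-≤-trans y<z z≤m)
    (cong₂ _xor_ (interval-inside ≤-refl w<x) (interval-below w<y (<-trans w<y y<z)))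
    (cong₂ _xor_ (interval-above (<⇒≤ w<x) ≤-refl) (interval-below x<y (<-trans x<y y<z)))
    (cong₂ _xor_ (interval-above (<⇒≤ (<-trans w<x x<y)) (<⇒≤ x<y)) (interval-inside ≤-refl y<z))
... | tri> _ _ y<x with <-cmp x z
...   | tri≈ _ x≡z _ = contradiction x≡z x≢z
...   | tri< x<z _ _ =
  -- overlapping intervals: 1, 0, 1 at w, y, x
  C-convex real w<y y<x (<-≤-trans x<z z≤m)
    (cong₂ _xor_ (interval-inside ≤-refl w<x) (interval-below w<y (<-trans w<y y<z)))
    (cong₂ _xor_ (interval-inside (<⇒≤ w<y) y<x) (interval-inside ≤-refl y<z))
    (cong₂ _xor_ (interval-above (<⇒≤ w<x) ≤-refl) (interval-inside (<⇒≤ y<x) x<z))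
...   | tri> _ _ z<x =
  -- nested intervals: 1, 0, 1 at w, y, z
  C-convex real w<y y<z (<-≤-trans z<x x≤m)
    (cong₂ _xor_ (interval-inside ≤-refl w<x) (interval-below w<y (<-trans w<y y<z)))
    (cong₂ _xor_ (interval-inside (<⇒≤ w<y) y<x) (interval-inside ≤-refl y<z))
    (cong₂ _xor_ (interval-inside (<⇒≤ (<-trans w<y y<z)) z<x) (interval-above (<⇒≤ y<z) ≤-refl))

two-intervals-ordered : ∀ {m v w x y z} → w < x → y < z →
  w ≢ y → w ≢ z → x ≢ y → x ≢ z → x ≤ m → z ≤ m →
  Realizes {m} v (interval-sum w x y z) → ¬ InC m v
two-intervals-ordered {w = w} {x} {y} {z} w<x y<z w≢y w≢z x≢y x≢z x≤m z≤m real
  with <-cmp w y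
... | tri< w<y _ _ = two-intervals-sorted w<x y<z w<y x≢y x≢z x≤m z≤m real
... | tri≈ _ w≡y _ = contradiction w≡y w≢y
... | tri> _ _ y<w = two-intervals-sorted y<z w<x y<w (w≢z ∘ sym) (x≢z ∘ sym) z≤m x≤m
  (realizes-≗ real λ u → xor-comm (interval w x u) (interval y z u))

two-intervals-half : ∀ {m v w x y z} → w < x → y ≢ z →
  w ≢ y → w ≢ z → x ≢ y → x ≢ z → x ≤ m → y ≤ m → z ≤ m →
  Realizes {m} v (interval-sum w x y z) → ¬ InC m v
two-intervals-half {w = w} {x} {y} {z} w<x y≢z w≢y w≢z x≢y x≢z x≤m y≤m z≤m real
  with <-cmp y z
... | tri< y<z _ _ = two-intervals-ordered w<x y<z w≢y w≢z x≢y x≢z x≤m z≤m real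
... | tri≈ _ y≡z _ = contradiction y≡z y≢z
... | tri> _ _ z<y = two-intervals-ordered w<x z<y w≢z w≢y x≢z x≢y x≤m y≤m
  (realizes-≗ real λ u → cong (interval w x u xor_) (interval-sym y z u))

two-intervals : ∀ {m v w x y z} → w ≢ x → y ≢ z →
  w ≢ y → w ≢ z → x ≢ y → x ≢ z → w ≤ m → x ≤ m → y ≤ m → z ≤ m →
  Realizes {m} v (interval-sum w x y z) → ¬ InC m v
two-intervals {w = w} {x} {y} {z} w≢x y≢z w≢y w≢z x≢y x≢z w≤m x≤m y≤m z≤m real
  with <-cmp w x
... | tri< w<x _ _ = two-intervals-half w<x y≢z w≢y w≢z x≢y x≢z x≤m y≤m z≤m real
... | tri≈ _ w≡x _ = contradiction w≡x w≢x
... | tri> _ _ x<w = two-intervals-half x<w y≢z x≢y x≢z w≢y w≢z w≤m y≤m z≤m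
  (realizes-≗ real λ u → cong (_xor interval y z u) (interval-sym w x u))

lookup-edgeCode-ordered : ∀ {m x y} → x ≤ y → y ≤ m → (t : Fin m) →
  lookup (edgeCode (suc m) x y) t ≡ interval (m ∸ y) (m ∸ x) (toℕ t)
lookup-edgeCode-ordered {m} {x} {y} x≤y y≤m t = begin
  lookup (edgeCode (suc m) x y) t
    ≡⟨ lookup∘tabulate _ t ⟩
  (suc m ∸ (x ⊔ y) ≤ᵇ toℕ t + 1) ∧ (toℕ t + 1 ≤ᵇ suc m ∸ (x ⊓ y) ∸ 1)
    ≡⟨ cong₂ (λ a b → (suc m ∸ a ≤ᵇ toℕ t + 1) ∧ (toℕ t + 1 ≤ᵇ suc m ∸ b ∸ 1))
             (m≤n⇒m⊔n≡n x≤y) (m≤n⇒m⊓n≡m x≤y) ⟩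
  (suc m ∸ y ≤ᵇ toℕ t + 1) ∧ (toℕ t + 1 ≤ᵇ suc m ∸ x ∸ 1)
    ≡⟨ cong₂ (λ a c → (a ≤ᵇ c) ∧ (c ≤ᵇ suc m ∸ x ∸ 1)) (+-∸-assoc 1 y≤m) (+-comm (toℕ t) 1) ⟩
  (suc (m ∸ y) ≤ᵇ suc (toℕ t)) ∧ (suc (toℕ t) ≤ᵇ suc m ∸ x ∸ 1)
    ≡⟨ cong (λ b → (suc (m ∸ y) ≤ᵇ suc (toℕ t)) ∧ (suc (toℕ t) ≤ᵇ b ∸ 1))
            (+-∸-assoc 1 (≤-trans x≤y y≤m)) ⟩
  (suc (m ∸ y) ≤ᵇ suc (toℕ t)) ∧ (suc (toℕ t) ≤ᵇ m ∸ x)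
    ≡⟨ window (toℕ t) (∸-monoʳ-≤ m x≤y) ⟩
  interval (m ∸ y) (m ∸ x) (toℕ t) ∎
  where open ≡-Reasoning

-- Fact (3) on ℕ: every step occurs twice in the sum of the three intervals
-- spanned by three ends a, b, c.
intervals-triangle : ∀ a b c u →
  (interval a b u xor interval a c u) xor interval b c u ≡ false
intervals-triangle a b c u = cancel (step a u) (step b u) (step c u)
  where
  cancel : ∀ p q r → ((p xor q) xor (p xor r)) xor (q xor r) ≡ false
  cancel false q     r     = xor-same (q xor r)
  cancel true  false false = refl
  cancel true  false true  = refl
  cancel true  true  false = refl
  cancel true  true  true  = refl

lookup-⊕ : ∀ {k} (p q : Vec Bool k) t → lookup (p ⊕ q) t ≡ lookup p t xor lookup q t
lookup-⊕ p q t = lookup-zipWith _xor_ t p q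

module _ {A : Set} where

  End : A → A → A → Set
  End v a b = v ≡ a ⊎ v ≡ b

  Ends : A → A → A → A → Set
  Ends v x a b = (a ≡ v × b ≡ x) ⊎ (a ≡ x × b ≡ v)

  Meet : A → A → A → A → Set
  Meet a b c d = Σ[ u ∈ A ] End u a b × End u c d

  other-end : ∀ {v a b} → End v a b → Σ[ x ∈ A ] Ends v x a b
  other-end {b = b} (inj₁ refl) = b , inj₁ (refl , refl)
  other-end {a = a} (inj₂ refl) = a , inj₂ (refl , refl)

  ends-sym : ∀ {B : Set} (f : A → A → B) → (∀ a b → f a b ≡ f b a) →
    ∀ {v x a b} → Ends v x a b → f a b ≡ f v x
  ends-sym f f-sym (inj₁ (refl , refl)) = refl
  ends-sym f f-sym (inj₂ (refl , refl)) = f-sym _ _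

  distinct-others : ∀ {B : Set} (f : A → A → B) → (∀ a b → f a b ≡ f b a) →
    ∀ {v x y a b c d} → Ends v x a b → Ends v y c d → f a b ≢ f c d → x ≢ y
  distinct-others f f-sym ab=vx cd=vy fab≢fcd refl =
    fab≢fcd (trans (ends-sym f f-sym ab=vx) (sym (ends-sym f f-sym cd=vy)))

  far-end-meets : ∀ {v x a b r s} → Ends v x a b → ¬ End v r s → Meet a b r s → End x r s
  far-end-meets (inj₁ (refl , refl)) v∉rs (_ , inj₁ refl , u∈rs) = contradiction u∈rs v∉rs
  far-end-meets (inj₁ (refl , refl)) v∉rs (_ , inj₂ refl , u∈rs) = u∈rs
  far-end-meets (inj₂ (refl , refl)) v∉rs (_ , inj₁ refl , u∈rs) = u∈rs
  far-end-meets (inj₂ (refl , refl)) v∉rs (_ , inj₂ refl , u∈rs) = contradiction u∈rs v∉rs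

  both-ends : ∀ {x y r s} → x ≢ y → End x r s → End y r s → Ends x y r s
  both-ends x≢y (inj₁ refl) (inj₁ refl) = contradiction refl x≢y
  both-ends x≢y (inj₁ refl) (inj₂ refl) = inj₁ (refl , refl)
  both-ends x≢y (inj₂ refl) (inj₁ refl) = inj₂ (refl , refl)
  both-ends x≢y (inj₂ refl) (inj₂ refl) = contradiction refl x≢y

edgeSet : ∀ {n} → Fin n → Fin n → Subset n
edgeSet a b = ⁅ a ⁆ ∪ ⁅ b ⁆

edgeSet-sym : ∀ {n} (a b : Fin n) → edgeSet a b ≡ edgeSet b a
edgeSet-sym a b = ∪-comm ⁅ a ⁆ ⁅ b ⁆

star : ∀ {n} {v x y : Fin n} → x ≢ y → edgeSet v x ∩ edgeSet v y ≡ ⁅ v ⁆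
star {v = v} {x} {y} x≢y = begin
  (⁅ v ⁆ ∪ ⁅ x ⁆) ∩ (⁅ v ⁆ ∪ ⁅ y ⁆) ≡⟨ sym (∪-distribˡ-∩ ⁅ v ⁆ ⁅ x ⁆ ⁅ y ⁆) ⟩
  ⁅ v ⁆ ∪ (⁅ x ⁆ ∩ ⁅ y ⁆)           ≡⟨ cong (⁅ v ⁆ ∪_) (Empty-unique singletons-disjoint) ⟩
  ⁅ v ⁆ ∪ ⊥                         ≡⟨ ∪-identityʳ ⁅ v ⁆ ⟩
  ⁅ v ⁆                             ∎
  where
  open ≡-Reasoning
  singletons-disjoint : Empty (⁅ x ⁆ ∩ ⁅ y ⁆)
  singletons-disjoint (u , u∈x∩y) with x∈p∩q⁻ ⁅ x ⁆ ⁅ y ⁆ u∈x∩y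
  ... | u∈x , u∈y = x≢y (trans (sym (x∈⁅y⁆⇒x≡y x u∈x)) (x∈⁅y⁆⇒x≡y y u∈y))

module _ {m : ℕ} where

  -- The position of vertex a: its edge codes change value at coordinate m - a.
  pos : Fin (suc m) → ℕ
  pos a = m ∸ toℕ a

  pos≤m : ∀ a → pos a ≤ m
  pos≤m a = m∸n≤m m (toℕ a)

  pos-injective : ∀ {a b} → pos a ≡ pos b → a ≡ b
  pos-injective {a} {b} eq = toℕ-injective (begin
    toℕ a           ≡⟨ sym (m∸[m∸n]≡n (toℕ≤pred[n] a)) ⟩
    m ∸ (m ∸ toℕ a) ≡⟨ cong (m ∸_) eq ⟩
    m ∸ (m ∸ toℕ b) ≡⟨ m∸[m∸n]≡n (toℕ≤pred[n] b) ⟩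
    toℕ b           ∎)
    where open ≡-Reasoning

  E : Fin (suc m) → Fin (suc m) → Vec Bool m
  E a b = edgeCode (suc m) (toℕ a) (toℕ b)

  E-sym : ∀ a b → E a b ≡ E b a
  E-sym a b rewrite ⊔-comm (toℕ a) (toℕ b) | ⊓-comm (toℕ a) (toℕ b) = refl

  lookup-E : ∀ a b t → lookup (E a b) t ≡ interval (pos a) (pos b) (toℕ t)
  lookup-E a b t with ≤-total (toℕ a) (toℕ b)
  ... | inj₁ a≤b = trans (lookup-edgeCode-ordered a≤b (toℕ≤pred[n] b) t) (interval-sym (pos b) (pos a) (toℕ t))
  ... | inj₂ b≤a = trans (cong (λ p → lookup p t) (E-sym a b))
                         (lookup-edgeCode-ordered b≤a (toℕ≤pred[n] a) t)

  lookup-E⊕E : ∀ a b c d t →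
    lookup (E a b ⊕ E c d) t ≡ interval-sum (pos a) (pos b) (pos c) (pos d) (toℕ t)
  lookup-E⊕E a b c d t =
    trans (lookup-⊕ (E a b) (E c d) t) (cong₂ _xor_ (lookup-E a b t) (lookup-E c d t))

  disjoint-notInC : ∀ {a b c d} → a ≢ b → c ≢ d →
    a ≢ c → a ≢ d → b ≢ c → b ≢ d → ¬ InC m (E a b ⊕ E c d)
  disjoint-notInC {a} {b} {c} {d} a≢b c≢d a≢c a≢d b≢c b≢d =
    two-intervals (a≢b ∘ pos-injective) (c≢d ∘ pos-injective)
      (a≢c ∘ pos-injective) (a≢d ∘ pos-injective) (b≢c ∘ pos-injective) (b≢d ∘ pos-injective)
      (pos≤m a) (pos≤m b) (pos≤m c) (pos≤m d) (realizes {v = E a b ⊕ E c d} (lookup-E⊕E a b c d))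

  edges-meet : ∀ {a b c d} → a ≢ b → c ≢ d → InC m (E a b ⊕ E c d) → Meet a b c d
  edges-meet {a} {b} {c} {d} a≢b c≢d inC with a ≟ c | a ≟ d | b ≟ c | b ≟ d
  ... | yes refl | _        | _        | _        = a , inj₁ refl , inj₁ refl
  ... | no _     | yes refl | _        | _        = a , inj₁ refl , inj₂ refl
  ... | no _     | no _     | yes refl | _        = b , inj₂ refl , inj₁ refl
  ... | no _     | no _     | no _     | yes refl = b , inj₂ refl , inj₂ refl
  ... | no a≢c   | no a≢d   | no b≢c   | no b≢d   =
    contradiction inC (disjoint-notInC a≢b c≢d a≢c a≢d b≢c b≢d)

  meet-at : ∀ {v a b c d} → End v a b → End v c d → E a b ≢ E c d →
    edgeSet a b ∩ edgeSet c d ≡ ⁅ v ⁆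
  meet-at {v} {a} {b} {c} {d} v∈ab v∈cd Eab≢Ecd with other-end v∈ab | other-end v∈cd
  ... | x , ab=vx | y , cd=vy = begin
    edgeSet a b ∩ edgeSet c d
      ≡⟨ cong₂ _∩_ (ends-sym edgeSet edgeSet-sym ab=vx) (ends-sym edgeSet edgeSet-sym cd=vy) ⟩
    edgeSet v x ∩ edgeSet v y
      ≡⟨ star (distinct-others E E-sym ab=vx cd=vy Eab≢Ecd) ⟩
    ⁅ v ⁆ ∎
    where open ≡-Reasoning

  triangle : ∀ v x y → (E v x ⊕ E v y) ⊕ E x y ≡ 𝟎 m
  triangle v x y = Pointwise-≡⇒≡ (ext λ t → begin
    lookup ((E v x ⊕ E v y) ⊕ E x y) t
      ≡⟨ lookup-⊕ (E v x ⊕ E v y) (E x y) t ⟩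
    lookup (E v x ⊕ E v y) t xor lookup (E x y) t
      ≡⟨ cong₂ _xor_ (lookup-E⊕E v x v y t) (lookup-E x y t) ⟩
    interval-sum (pos v) (pos x) (pos v) (pos y) (toℕ t) xor interval (pos x) (pos y) (toℕ t)
      ≡⟨ intervals-triangle (pos v) (pos x) (pos y) (toℕ t) ⟩
    false
      ≡⟨ sym (lookup-replicate t false) ⟩
    lookup (𝟎 m) t ∎)
    where open ≡-Reasoning

  star-case : ∀ {v i j k l r s} → End v i j → End v k l → End v r s →
    E i j ≢ E k l → E k l ≢ E r s → E i j ≢ E r s →
    (edgeSet i j ∩ edgeSet k l ≡ edgeSet i j ∩ edgeSet r s)
    × (edgeSet i j ∩ edgeSet r s ≡ edgeSet k l ∩ edgeSet r s)
  star-case {v} {i} {j} {k} {l} {r} {s} v∈ij v∈kl v∈rs E₁₂ E₂₃ E₁₃ =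
    trans meet₁₂ (sym meet₁₃) , trans meet₁₃ (sym meet₂₃)
    where
    meet₁₂ : edgeSet i j ∩ edgeSet k l ≡ ⁅ v ⁆
    meet₁₂ = meet-at v∈ij v∈kl E₁₂
    meet₁₃ : edgeSet i j ∩ edgeSet r s ≡ ⁅ v ⁆
    meet₁₃ = meet-at v∈ij v∈rs E₁₃
    meet₂₃ : edgeSet k l ∩ edgeSet r s ≡ ⁅ v ⁆
    meet₂₃ = meet-at v∈kl v∈rs E₂₃

  -- Distinct edges {v,x}, {v,y} both meeting an edge {r,s} avoiding v: then
  -- {r,s} = {x,y}, the three edges form a triangle and their codes sum to zero.
  triangle-case : ∀ {v i j k l r s} → End v i j → End v k l → ¬ End v r s →
    Meet i j r s → Meet k l r s → E i j ≢ E k l → (E i j ⊕ E k l) ⊕ E r s ≡ 𝟎 m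
  triangle-case {v} {i} {j} {k} {l} {r} {s} v∈ij v∈kl v∉rs meet₁₃ meet₂₃ E₁₂
    with other-end v∈ij | other-end v∈kl
  ... | x , ij=vx | y , kl=vy = begin
    (E i j ⊕ E k l) ⊕ E r s
      ≡⟨ cong₂ (λ p q → (p ⊕ q) ⊕ E r s) (ends-sym E E-sym ij=vx) (ends-sym E E-sym kl=vy) ⟩
    (E v x ⊕ E v y) ⊕ E r s
      ≡⟨ cong ((E v x ⊕ E v y) ⊕_) (ends-sym E E-sym rs=xy) ⟩
    (E v x ⊕ E v y) ⊕ E x y
      ≡⟨ triangle v x y ⟩
    𝟎 m ∎
    where
    open ≡-Reasoning
    rs=xy : Ends x y r s
    rs=xy = both-ends (distinct-others E E-sym ij=vx kl=vy E₁₂)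
                      (far-end-meets ij=vx v∉rs meet₁₃) (far-end-meets kl=vy v∉rs meet₂₃)

  three-edges : ∀ {i j k l r s} → Meet i j k l → Meet i j r s → Meet k l r s →
    E i j ≢ E k l → E k l ≢ E r s → E i j ≢ E r s →
    ((E i j ⊕ E k l) ⊕ E r s ≡ 𝟎 m)
    ⊎ ((edgeSet i j ∩ edgeSet k l ≡ edgeSet i j ∩ edgeSet r s)
       × (edgeSet i j ∩ edgeSet r s ≡ edgeSet k l ∩ edgeSet r s))
  three-edges {r = r} {s} (v , v∈ij , v∈kl) meet₁₃ meet₂₃ E₁₂ E₂₃ E₁₃
    with v ≟ r ⊎-dec v ≟ s
  ... | yes v∈rs = inj₂ (star-case v∈ij v∈kl v∈rs E₁₂ E₂₃ E₁₃)
  ... | no v∉rs  = inj₁ (triangle-case v∈ij v∈kl v∉rs meet₁₃ meet₂₃ E₁₂)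

lemma5 : (n : ℕ) → 2 ≤ n → (i j k l r s : Fin n) →
    i ≢ j → k ≢ l → r ≢ s →
    (p₁ p₂ p₃ : Vec Bool (n ∸ 1)) →
    p₁ ≡ edgeCode n (toℕ i) (toℕ j) →
    p₂ ≡ edgeCode n (toℕ k) (toℕ l) →
    p₃ ≡ edgeCode n (toℕ r) (toℕ s) →
    p₁ ≢ p₂ → p₂ ≢ p₃ → p₁ ≢ p₃ →
    InC (n ∸ 1) (p₁ ⊕ p₂) → InC (n ∸ 1) (p₂ ⊕ p₃) → InC (n ∸ 1) (p₁ ⊕ p₃) →
    ((p₁ ⊕ p₂) ⊕ p₃ ≡ 𝟎 (n ∸ 1))
    ⊎ ((((⁅ i ⁆ ∪ ⁅ j ⁆) ∩ (⁅ k ⁆ ∪ ⁅ l ⁆)) ≡ ((⁅ i ⁆ ∪ ⁅ j ⁆) ∩ (⁅ r ⁆ ∪ ⁅ s ⁆)))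
    × (((⁅ i ⁆ ∪ ⁅ j ⁆) ∩ (⁅ r ⁆ ∪ ⁅ s ⁆)) ≡ ((⁅ k ⁆ ∪ ⁅ l ⁆) ∩ (⁅ r ⁆ ∪ ⁅ s ⁆))))
lemma5 (suc m) _ i j k l r s i≢j k≢l r≢s ._ ._ ._ refl refl refl
  p₁≢p₂ p₂≢p₃ p₁≢p₃ sum₁₂∈C sum₂₃∈C sum₁₃∈C =
  three-edges (edges-meet i≢j k≢l sum₁₂∈C) (edges-meet i≢j r≢s sum₁₃∈C)
              (edges-meet k≢l r≢s sum₂₃∈C) p₁≢p₂ p₂≢p₃ p₁≢p₃
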